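{- Let $G=(V,E)$ be a finite simple maximally connected graph with minimum degree $\delta(G)$ and $|V|\geq 2(\delta(G)-h)+1$, and let $h$ be an integer with $0\leq h\leq \delta(G)$. Then the $h$-edge tolerable diagnosability of $G$ under the PMC model is $t_h^e(G)=\delta(G)-h$.
   Context: A graph $G$ is maximally connected if its minimum degree $\delta(G)$ equals its vertex connectivity $\kappa(G)$ (the minimum size of a vertex set $S$ such that $G-S$ is disconnected or trivial). For sets $A,B$, $A-B$ is set difference and $F_1\bigtriangleup F_2=(F_1-F_2)\cup(F_2-F_1)$. Under the PMC model, a graph $G=(V,E)$ is $t$-diagnosable if and only if for any two distinct subsets $F_1,F_2\subseteq V$ with $|F_1|\leq t$ and $|F_2|\leq t$, there is an edge joining a vertex of $V-(F_1\cup F_2)$ to a vertex of $F_1\bigtriangleup F_2$. A graph $G$ is $h$-edge tolerable $t$-diagnosable under the model if for every edge subset $F_e\subseteq E$ with $|F_e|\leq h$, the graph $G-F_e$ is $t$-diagnosable under the model; the $h$-edge tolerable diagnosability $t_h^e(G)$ is the maximum integer $t$ such that $G$ is $h$-edge tolerable $t$-diagnosable. -}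

module Defs where

open import Data.Nat using (ℕ; _≤_; _+_; _*_; _∸_)
open import Data.Bool using (Bool; true; false)
open import Data.Fin using (Fin)
open import Data.Fin.Subset using (Subset; _∈_; _∉_; _∪_; _─_; ∁; ∣_∣)
open import Data.Vec using (tabulate)
open import Data.List using (List; length)
open import Data.List.Membership.Propositional using () renaming (_∈_ to _∈ₗ_)
open import Data.Product using (Σ; _×_; _,_; ∃; ∃-syntax)
open import Data.Sum using (_⊎_)
open import Relation.Nullary using (¬_)
open import Relation.Binary.PropositionalEquality using (_≡_; _≢_)

record Graph (n : ℕ) : Set where
  field
    adj   : Fin n → Fin n → Bool
    sym   : ∀ u v → adj u v ≡ adj v u
    irrefl : ∀ v → adj v v ≡ false
open Graph public

degree : ∀ {n} → Graph n → Fin n → ℕ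
degree G v = ∣ tabulate (adj G v) ∣

IsMinDegree : ∀ {n} → Graph n → ℕ → Set
IsMinDegree {n} G d = (∃[ v ] degree G v ≡ d) × (∀ v → d ≤ degree G v)

data Reach {n} (G : Graph n) (S : Subset n) : Fin n → Fin n → Set where
  here : ∀ {u} → u ∉ S → Reach G S u u
  step : ∀ {u v w} → u ∉ S → adj G u v ≡ true → Reach G S v w → Reach G S u w

DisconnectedOrTrivial : ∀ {n} → Graph n → Subset n → Set
DisconnectedOrTrivial G S =
  (∃[ u ] ∃[ v ] (u ∉ S × v ∉ S × ¬ Reach G S u v)) ⊎ (∣ ∁ S ∣ ≤ 1)

IsConnectivity : ∀ {n} → Graph n → ℕ → Set
IsConnectivity {n} G k =
  (∃[ S ] (∣ S ∣ ≡ k × DisconnectedOrTrivial G S)) ×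
  (∀ (S : Subset n) → DisconnectedOrTrivial G S → k ≤ ∣ S ∣)

MaximallyConnected : ∀ {n} → Graph n → Set
MaximallyConnected G = ∀ d k → IsMinDegree G d → IsConnectivity G k → d ≡ k

-- An edge set F_e given as a list of vertex pairs, each an edge of G;
-- |F_e| ≤ h is expressed by length ≤ h.
EdgeList : ℕ → Set
EdgeList n = List (Fin n × Fin n)

EdgesOf : ∀ {n} → Graph n → EdgeList n → Set
EdgesOf G F = ∀ {u v} → (u , v) ∈ₗ F → adj G u v ≡ true

AdjMinus : ∀ {n} → Graph n → EdgeList n → Fin n → Fin n → Set
AdjMinus G F u v = adj G u v ≡ true × ¬ ((u , v) ∈ₗ F) × ¬ ((v , u) ∈ₗ F)

_△_ : ∀ {n} → Subset n → Subset n → Subset n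
A △ B = (A ─ B) ∪ (B ─ A)

Diagnosable : ∀ {n} → (Fin n → Fin n → Set) → ℕ → Set
Diagnosable {n} Adj t =
  ∀ (F₁ F₂ : Subset n) → F₁ ≢ F₂ → ∣ F₁ ∣ ≤ t → ∣ F₂ ∣ ≤ t →
  ∃[ u ] ∃[ v ] (u ∉ (F₁ ∪ F₂) × v ∈ (F₁ △ F₂) × Adj u v)

EdgeTolerableDiagnosable : ∀ {n} → Graph n → ℕ → ℕ → Set
EdgeTolerableDiagnosable G h t =
  ∀ (F : EdgeList _) → EdgesOf G F → length F ≤ h → Diagnosable (AdjMinus G F) t

IsEdgeTolerableDiagnosability : ∀ {n} → Graph n → ℕ → ℕ → Set
IsEdgeTolerableDiagnosability G h t =
  EdgeTolerableDiagnosable G h t × (∀ t' → EdgeTolerableDiagnosable G h t' → t' ≤ t)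

-- Deleting one edge xy lowers the size of a smallest
-- disconnecting set by at most one (add an endpoint of xy to a disconnecting
-- set of G - xy), so in G - F every disconnecting set has at least
-- κ(G) - |F| ≥ δ - h vertices.  A graph on at least 2t + 1 vertices whose
-- disconnecting sets all have at least t vertices is t-diagnosable: if no edge
-- joins V - (F₁ ∪ F₂) to F₁ △ F₂, then F₁ ∩ F₂, which has fewer than t
-- vertices, separates F₁ △ F₂ from a vertex outside F₁ ∪ F₂.  At a vertex v of degree δ delete h of its edges; the remaining
-- neighbours P satisfy |P| ≤ δ - h, and the fault sets P and P ∪ {v} cannot
-- be distinguished, so G - F is not (δ - h + 1)-diagnosable.
--
-- Statements about reachability are classical; they are proved in the
-- double-negation monad and discharged at decidable conclusions.
module Submission where

open import Defs hiding (sym)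
open import Data.Nat using (ℕ; zero; suc; _≤_; _<_; _+_; _*_; _∸_; z≤n; s≤s; _≤?_)
open import Data.Nat.Properties
open import Data.Nat.Induction using (<-wellFounded)
open import Induction.WellFounded using (Acc; acc)
open import Data.Bool using (Bool; true; false; _∧_; _∨_; not)
open import Data.Bool.Properties using (∨-comm) renaming (_≟_ to _≟ᵇ_)
open import Data.Fin using (Fin) renaming (_≟_ to _≟ᶠ_)
open import Data.Fin.Properties using (any?)
open import Data.Fin.Subset using (Subset; _∈_; _∉_; _∪_; _∩_; _─_; ∁; ∣_∣; ⁅_⁆; ⊤; inside; outside; _⊆_)
open import Data.Fin.Subset.Properties
  using (_∈?_; x∈p∪q⁻; x∈p∪q⁺; x∈p∩q⁻; x∈p∩q⁺; x∈p∧x∉q⇒x∈p─q; x∈⁅x⁆; x∈⁅y⁆⇒x≡y; ∣⁅x⁆∣≡1;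
         p⊆q⇒∣p∣≤∣q∣; p⊂q⇒∣p∣<∣q∣; p∩q⊆p; p∩q⊆q; x∈∁p⇒x∉p; ⊆-antisym; ⊆⊤; ∣⊤∣≡n)
open import Data.Vec using ([]; _∷_; tabulate; here; there)
open import Data.Vec.Properties using ([]=⇒lookup; lookup⇒[]=; lookup∘tabulate)
open import Data.List using (List; []; _∷_; length; map)
open import Data.List.Properties using (length-map)
open import Data.List.Relation.Unary.Any using (here; there)
open import Data.List.Membership.Propositional using () renaming (_∈_ to _∈ₗ_)
open import Data.List.Membership.Propositional.Properties using (∈-map⁺; ∈-map⁻)
open import Data.Product using (_×_; _,_; ∃-syntax; uncurry)
open import Data.Product.Properties using (≡-dec)
import Data.Product as Product
open import Data.Sum using (_⊎_; inj₁; inj₂)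
import Data.Sum as Sum
open import Data.Empty using (⊥-elim)
open import Function using (_∘_)
open import Level using (0ℓ)
open import Effect.Monad using (RawMonad)
open import Relation.Nullary using (¬_; Dec; yes; no; does)
open import Relation.Nullary.Negation using (¬¬-Monad)
open import Relation.Nullary.Decidable using (decidable-stable; ¬¬-excluded-middle; ¬?; _×-dec_)
open import Relation.Binary.Definitions using (DecidableEquality)
open import Relation.Binary.PropositionalEquality
  using (_≡_; _≢_; refl; sym; trans; cong; cong₂; subst)

open RawMonad (¬¬-Monad {a = 0ℓ}) using (_>>=_; return)

private variable
  n : ℕ

∣p∪q∣≤∣p∣+∣q∣ : (p q : Subset n) → ∣ p ∪ q ∣ ≤ ∣ p ∣ + ∣ q ∣
∣p∪q∣≤∣p∣+∣q∣ [] [] = z≤n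
∣p∪q∣≤∣p∣+∣q∣ (inside ∷ p) (inside ∷ q) =
  s≤s (≤-trans (∣p∪q∣≤∣p∣+∣q∣ p q) (+-monoʳ-≤ ∣ p ∣ (n≤1+n ∣ q ∣)))
∣p∪q∣≤∣p∣+∣q∣ (inside ∷ p) (outside ∷ q) = s≤s (∣p∪q∣≤∣p∣+∣q∣ p q)
∣p∪q∣≤∣p∣+∣q∣ (outside ∷ p) (inside ∷ q) =
  ≤-trans (s≤s (∣p∪q∣≤∣p∣+∣q∣ p q)) (≤-reflexive (sym (+-suc ∣ p ∣ ∣ q ∣)))
∣p∪q∣≤∣p∣+∣q∣ (outside ∷ p) (outside ∷ q) = ∣p∪q∣≤∣p∣+∣q∣ p q

∣p∪⁅x⁆∣≤1+∣p∣ : (p : Subset n) (x : Fin n) → ∣ p ∪ ⁅ x ⁆ ∣ ≤ suc ∣ p ∣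
∣p∪⁅x⁆∣≤1+∣p∣ p x = begin
  ∣ p ∪ ⁅ x ⁆ ∣     ≤⟨ ∣p∪q∣≤∣p∣+∣q∣ p ⁅ x ⁆ ⟩
  ∣ p ∣ + ∣ ⁅ x ⁆ ∣ ≡⟨ cong (∣ p ∣ +_) (∣⁅x⁆∣≡1 x) ⟩
  ∣ p ∣ + 1         ≡⟨ +-comm ∣ p ∣ 1 ⟩
  suc ∣ p ∣         ∎
  where open ≤-Reasoning

x∉p∪⁅y⁆⁺ : ∀ {p : Subset n} {x y} → x ∉ p → x ≢ y → x ∉ p ∪ ⁅ y ⁆
x∉p∪⁅y⁆⁺ {p = p} {y = y} x∉p x≢y x∈ with x∈p∪q⁻ p ⁅ y ⁆ x∈
... | inj₁ x∈p = x∉p x∈p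
... | inj₂ x∈y = x≢y (x∈⁅y⁆⇒x≡y y x∈y)

x∉p∪⁅y⁆⁻ : ∀ {p : Subset n} {x y} → x ∉ p ∪ ⁅ y ⁆ → x ∉ p × x ≢ y
x∉p∪⁅y⁆⁻ {y = y} x∉ = (λ x∈p → x∉ (x∈p∪q⁺ (inj₁ x∈p))) , λ { refl → x∉ (x∈p∪q⁺ (inj₂ (x∈⁅x⁆ y))) }

x∈p─q⁻ : ∀ {x : Fin n} (p q : Subset n) → x ∈ p ─ q → x ∈ p × x ∉ q
x∈p─q⁻ (s ∷ p) (outside ∷ q) here = here , λ ()
x∈p─q⁻ {x = Fin.zero} (s ∷ p) (inside ∷ q) ()
x∈p─q⁻ (s ∷ p) (t ∷ q) (there m) =
  Product.map there (λ x∉q → λ { (there x∈q) → x∉q x∈q }) (x∈p─q⁻ p q m)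

x∈p△q⁻ : ∀ {x : Fin n} (p q : Subset n) → x ∈ p △ q → (x ∈ p × x ∉ q) ⊎ (x ∈ q × x ∉ p)
x∈p△q⁻ p q m = Sum.map (x∈p─q⁻ p q) (x∈p─q⁻ q p) (x∈p∪q⁻ (p ─ q) (q ─ p) m)

x∈p△q⁺ : ∀ {x : Fin n} {p q : Subset n} → (x ∈ p × x ∉ q) ⊎ (x ∈ q × x ∉ p) → x ∈ p △ q
x∈p△q⁺ = x∈p∪q⁺ ∘ Sum.map (uncurry x∈p∧x∉q⇒x∈p─q) (uncurry x∈p∧x∉q⇒x∈p─q)

∪⊆∩∪△ : ∀ {x : Fin n} (p q : Subset n) → x ∈ p ∪ q → x ∈ p ∩ q ⊎ x ∈ p △ q
∪⊆∩∪△ {x = x} p q x∈ with x ∈? p | x ∈? q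
... | yes x∈p | yes x∈q = inj₁ (x∈p∩q⁺ (x∈p , x∈q))
... | yes x∈p | no x∉q = inj₂ (x∈p△q⁺ (inj₁ (x∈p , x∉q)))
... | no x∉p | yes x∈q = inj₂ (x∈p△q⁺ (inj₂ (x∈q , x∉p)))
... | no x∉p | no x∉q = ⊥-elim (Sum.[ x∉p , x∉q ] (x∈p∪q⁻ p q x∈))

∩⊆∪ : ∀ {x : Fin n} (p q : Subset n) → x ∈ p ∩ q → x ∈ p ∪ q
∩⊆∪ p q = x∈p∪q⁺ ∘ inj₁ ∘ Product.proj₁ ∘ x∈p∩q⁻ p q

△⊆∪ : ∀ {x : Fin n} (p q : Subset n) → x ∈ p △ q → x ∈ p ∪ q
△⊆∪ p q = x∈p∪q⁺ ∘ Sum.map Product.proj₁ Product.proj₁ ∘ x∈p△q⁻ p q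

△∩-disjoint : ∀ {x : Fin n} (p q : Subset n) → x ∈ p △ q → x ∉ p ∩ q
△∩-disjoint p q x∈△ x∈∩ with x∈p∩q⁻ p q x∈∩ | x∈p△q⁻ p q x∈△
... | _ , x∈q | inj₁ (_ , x∉q) = x∉q x∈q
... | x∈p , _ | inj₂ (_ , x∉p) = x∉p x∈p

∣p∩q∣<∣p∣ : ∀ {x : Fin n} (p q : Subset n) → x ∈ p → x ∉ q → ∣ p ∩ q ∣ < ∣ p ∣
∣p∩q∣<∣p∣ {x = x} p q x∈p x∉q =
  p⊂q⇒∣p∣<∣q∣ (p∩q⊆p p q , x , x∈p , x∉q ∘ Product.proj₂ ∘ x∈p∩q⁻ p q)

∣p∩q∣<∣q∣ : ∀ {x : Fin n} (p q : Subset n) → x ∈ q → x ∉ p → ∣ p ∩ q ∣ < ∣ q ∣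
∣p∩q∣<∣q∣ {x = x} p q x∈q x∉p =
  p⊂q⇒∣p∣<∣q∣ (p∩q⊆q p q , x , x∈q , x∉p ∘ Product.proj₁ ∘ x∈p∩q⁻ p q)

≢⇒∃∈△ : ∀ {p q : Subset n} → p ≢ q → ∃[ x ] x ∈ p △ q
≢⇒∃∈△ {p = p} {q} p≢q with any? (λ x → x ∈? p △ q)
... | yes found = found
... | no none = ⊥-elim (p≢q (⊆-antisym (⊆-from inj₁) (⊆-from inj₂)))
  where
  ⊆-from : ∀ {a b} → (∀ {x} → x ∈ a × x ∉ b → (x ∈ p × x ∉ q) ⊎ (x ∈ q × x ∉ p)) → a ⊆ b
  ⊆-from {b = b} differ {x} x∈a with x ∈? b
  ... | yes x∈b = x∈b
  ... | no x∉b = ⊥-elim (none (x , x∈p△q⁺ (differ (x∈a , x∉b))))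

∃∉ : ∀ (p : Subset n) → ∣ p ∣ < n → ∃[ x ] x ∉ p
∃∉ {n} p ∣p∣<n with any? (λ x → ¬? (x ∈? p))
... | yes found = found
... | no none = ⊥-elim (<-irrefl (trans (cong ∣_∣ p≡⊤) (∣⊤∣≡n n)) ∣p∣<n)
  where
  p≡⊤ : p ≡ ⊤
  p≡⊤ = ⊆-antisym ⊆⊤ λ {x} _ → decidable-stable (x ∈? p) (λ x∉p → none (x , x∉p))

Closed : Graph n → Subset n → (Fin n → Set) → Set
Closed G T C = ∀ {c w} → c ∉ T → w ∉ T → adj G c w ≡ true → C c → C w

module _ (G : Graph n) {T : Subset n} where

  reach-start∉ : ∀ {u v} → Reach G T u v → u ∉ T
  reach-start∉ (here u∉T) = u∉T
  reach-start∉ (step u∉T _ _) = u∉T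

  reach-snoc : ∀ {u c w} → Reach G T u c → w ∉ T → adj G c w ≡ true → Reach G T u w
  reach-snoc (here c∉T) w∉T cw = step c∉T cw (here w∉T)
  reach-snoc (step u∉T uv r) w∉T cw = step u∉T uv (reach-snoc r w∉T cw)

  reach-closed : ∀ {u} → Closed G T (Reach G T u)
  reach-closed _ w∉T cw r = reach-snoc r w∉T cw

  closed-reach : ∀ {C u v} → Closed G T C → C u → Reach G T u v → C v
  closed-reach closed Cu (here _) = Cu
  closed-reach closed Cu (step u∉T uv r) = closed-reach closed (closed u∉T (reach-start∉ r) uv Cu) r

  closed⇒disconnecting : ∀ {C p q} → Closed G T C → p ∉ T → q ∉ T → C p → ¬ C q →
                         DisconnectedOrTrivial G T
  closed⇒disconnecting closed p∉T q∉T Cp ¬Cq =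
    inj₁ (_ , _ , p∉T , q∉T , λ r → ¬Cq (closed-reach closed Cp r))

CutWithin : Graph n → ℕ → Set
CutWithin {n} G m = ∃[ T ] (∣ T ∣ ≤ m × DisconnectedOrTrivial G T)

module _ (G : Graph n) {T : Subset n} {C : Fin n → Set} where

  cut-adding : ∀ z {p q} → Closed G (T ∪ ⁅ z ⁆) C → p ∉ T → q ∉ T → p ≢ z → q ≢ z →
               C p → ¬ C q → CutWithin G (suc ∣ T ∣)
  cut-adding z closed p∉T q∉T p≢z q≢z Cp ¬Cq =
    T ∪ ⁅ z ⁆ , ∣p∪⁅x⁆∣≤1+∣p∣ T z ,
    closed⇒disconnecting G closed (x∉p∪⁅y⁆⁺ p∉T p≢z) (x∉p∪⁅y⁆⁺ q∉T q≢z) Cp ¬Cq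

  -- The case u = a, v = b of cut-at-crossing: a third vertex w outside T lies
  -- in C (then T ∪ {a} separates w from b) or not (then T ∪ {b} separates a
  -- from w); without a third vertex, G - (T ∪ {a}) has only the vertex b.
  cut-at-endpoints : ∀ {a b} → Closed G (T ∪ ⁅ a ⁆) C → Closed G (T ∪ ⁅ b ⁆) C →
                     a ∉ T → b ∉ T → C a → ¬ C b → ¬ ¬ CutWithin G (suc ∣ T ∣)
  cut-at-endpoints {a} {b} closedA closedB a∉T b∉T Ca ¬Cb
    with any? (λ w → ¬? (w ∈? T) ×-dec ¬? (w ≟ᶠ a) ×-dec ¬? (w ≟ᶠ b))
  ... | yes (w , w∉T , w≢a , w≢b) = do
        Cw? ← ¬¬-excluded-middle
        return (by-third Cw?)
    where
    a≢b : a ≢ b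
    a≢b refl = ¬Cb Ca
    by-third : Dec (C w) → CutWithin G (suc ∣ T ∣)
    by-third (yes Cw) = cut-adding a closedA w∉T b∉T w≢a (a≢b ∘ sym) Cw ¬Cb
    by-third (no ¬Cw) = cut-adding b closedB a∉T w∉T a≢b w≢b Ca ¬Cw
  ... | no none = return (T ∪ ⁅ a ⁆ , ∣p∪⁅x⁆∣≤1+∣p∣ T a , inj₂ only-b)
    where
    rest⊆⁅b⁆ : ∁ (T ∪ ⁅ a ⁆) ⊆ ⁅ b ⁆
    rest⊆⁅b⁆ {w} w∈ with x∉p∪⁅y⁆⁻ (x∈∁p⇒x∉p w∈) | w ≟ᶠ b
    ... | _ | yes refl = x∈⁅x⁆ b
    ... | w∉T , w≢a | no w≢b = ⊥-elim (none (w , w∉T , w≢a , w≢b))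
    only-b : ∣ ∁ (T ∪ ⁅ a ⁆) ∣ ≤ 1
    only-b = ≤-trans (p⊆q⇒∣p∣≤∣q∣ rest⊆⁅b⁆) (≤-reflexive (∣⁅x⁆∣≡1 b))

  cut-at-crossing : ∀ {a b u v} → Closed G (T ∪ ⁅ a ⁆) C → Closed G (T ∪ ⁅ b ⁆) C →
                    u ∉ T → v ∉ T → u ≢ b → v ≢ a → C u → ¬ C v → ¬ ¬ CutWithin G (suc ∣ T ∣)
  cut-at-crossing {a} {b} {u} {v} closedA closedB u∉T v∉T u≢b v≢a Cu ¬Cv with v ≟ᶠ b | u ≟ᶠ a
  ... | no v≢b   | _        = return (cut-adding b closedB u∉T v∉T u≢b v≢b Cu ¬Cv)
  ... | yes refl | no u≢a   = return (cut-adding a closedA u∉T v∉T u≢a v≢a Cu ¬Cv)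
  ... | yes refl | yes refl = cut-at-endpoints closedA closedB u∉T v∉T Cu ¬Cv

_≟ₑ_ : DecidableEquality (Fin n × Fin n)
_≟ₑ_ = ≡-dec _≟ᶠ_ _≟ᶠ_

isEdge : Fin n × Fin n → Fin n → Fin n → Bool
isEdge e u v = does ((u , v) ≟ₑ e) ∨ does ((v , u) ≟ₑ e)

deleteEdge : Graph n → Fin n × Fin n → Graph n
deleteEdge G e = record
  { adj    = λ u v → adj G u v ∧ not (isEdge e u v)
  ; sym    = λ u v → cong₂ _∧_ (Graph.sym G u v) (cong not (∨-comm (does ((u , v) ≟ₑ e)) _))
  ; irrefl = λ v → cong (_∧ not (isEdge e v v)) (Graph.irrefl G v)
  }

deleteEdges : Graph n → EdgeList n → Graph n
deleteEdges G [] = G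
deleteEdges G (e ∷ F) = deleteEdge (deleteEdges G F) e

module _ (G : Graph n) where

  deleteEdge-adj⁻ : ∀ e {u v} → adj (deleteEdge G e) u v ≡ true →
                    adj G u v ≡ true × (u , v) ≢ e × (v , u) ≢ e
  deleteEdge-adj⁻ e {u} {v} uv with adj G u v | (u , v) ≟ₑ e | (v , u) ≟ₑ e
  ... | true | no uv≢e | no vu≢e = refl , uv≢e , vu≢e
  deleteEdge-adj⁻ e () | false | _ | _
  deleteEdge-adj⁻ e () | true | yes _ | _
  deleteEdge-adj⁻ e () | true | no _ | yes _

  deleteEdge-cases : ∀ e {u v} → adj G u v ≡ true →
                     adj (deleteEdge G e) u v ≡ true ⊎ ((u , v) ≡ e ⊎ (v , u) ≡ e)
  deleteEdge-cases e {u} {v} uv with (u , v) ≟ₑ e | (v , u) ≟ₑ e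
  ... | yes uv≡e | _        = inj₂ (inj₁ uv≡e)
  ... | no _     | yes vu≡e = inj₂ (inj₂ vu≡e)
  ... | no _     | no _     = inj₁ (cong (_∧ true) uv)

deleteEdges-adj⁻ : ∀ (G : Graph n) F {u v} → adj (deleteEdges G F) u v ≡ true → AdjMinus G F u v
deleteEdges-adj⁻ G [] uv = uv , (λ ()) , (λ ())
deleteEdges-adj⁻ G (e ∷ F) uv with deleteEdge-adj⁻ (deleteEdges G F) e uv
... | uv′ , uv≢e , vu≢e with deleteEdges-adj⁻ G F uv′
... | uv″ , uv∉F , vu∉F = uv″ , ∉-∷ uv≢e uv∉F , ∉-∷ vu≢e vu∉F
  where
  ∉-∷ : ∀ {x : Fin _ × Fin _} {F} → x ≢ e → ¬ x ∈ₗ F → ¬ x ∈ₗ e ∷ F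
  ∉-∷ x≢e x∉F (here x≡e) = x≢e x≡e
  ∉-∷ x≢e x∉F (there x∈F) = x∉F x∈F

module _ (G : Graph n) (x y : Fin n) {T : Subset n} {C : Fin n → Set} where

  private
    G-xy : Graph n
    G-xy = deleteEdge G (x , y)

  closed-both : Closed G-xy T C → (C x → C y) → (C y → C x) → Closed G T C
  closed-both closed x→y y→x c∉T w∉T cw Cc with deleteEdge-cases G (x , y) cw
  ... | inj₁ cw′          = closed c∉T w∉T cw′ Cc
  ... | inj₂ (inj₁ refl) = x→y Cc
  ... | inj₂ (inj₂ refl) = y→x Cc

  -- A predicate closed in (G - xy) - T is closed in G - (T ∪ {z}) for each
  -- endpoint z of xy, since the deleted edge then has an endpoint removed.
  closed-endpoint : ∀ {z} → z ≡ x ⊎ z ≡ y → Closed G-xy T C → Closed G (T ∪ ⁅ z ⁆) C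
  closed-endpoint z∈xy closed c∉ w∉ cw Cc with x∉p∪⁅y⁆⁻ c∉ | x∉p∪⁅y⁆⁻ w∉ | deleteEdge-cases G (x , y) cw
  ... | c∉T , _ | w∉T , _ | inj₁ cw′ = closed c∉T w∉T cw′ Cc
  ... | _ , x≢z | _ , y≢z | inj₂ (inj₁ refl) = ⊥-elim (Sum.[ x≢z ∘ sym , y≢z ∘ sym ] z∈xy)
  ... | _ , y≢z | _ , x≢z | inj₂ (inj₂ refl) = ⊥-elim (Sum.[ x≢z ∘ sym , y≢z ∘ sym ] z∈xy)

-- Let T separate u from v in G - xy and let C be the set reachable from u.
-- If C contains both or neither endpoint, T is already a cut of G; otherwise
-- one endpoint lies in C and the other does not, and cut-at-crossing applies.
deleteEdge-cut : ∀ (G : Graph n) x y {T} → DisconnectedOrTrivial (deleteEdge G (x , y)) T →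
                 ¬ ¬ CutWithin G (suc ∣ T ∣)
deleteEdge-cut G x y {T} (inj₂ trivial) = return (T , n≤1+n _ , inj₂ trivial)
deleteEdge-cut G x y {T} (inj₁ (u , v , u∉T , v∉T , ¬u⇝v)) = do
    Cx? ← ¬¬-excluded-middle
    Cy? ← ¬¬-excluded-middle
    by-endpoints Cx? Cy?
  where
  C : Fin _ → Set
  C = Reach (deleteEdge G (x , y)) T u
  closed : Closed (deleteEdge G (x , y)) T C
  closed = reach-closed (deleteEdge G (x , y))
  closedX : Closed G (T ∪ ⁅ x ⁆) C
  closedX = closed-endpoint G x y (inj₁ refl) closed
  closedY : Closed G (T ∪ ⁅ y ⁆) C
  closedY = closed-endpoint G x y (inj₂ refl) closed
  Cu : C u
  Cu = here u∉T
  T-cuts : (C x → C y) → (C y → C x) → ¬ ¬ CutWithin G (suc ∣ T ∣)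
  T-cuts x→y y→x =
    return (T , n≤1+n _ , closed⇒disconnecting G (closed-both G x y closed x→y y→x) u∉T v∉T Cu ¬u⇝v)
  by-endpoints : Dec (C x) → Dec (C y) → ¬ ¬ CutWithin G (suc ∣ T ∣)
  by-endpoints (yes Cx) (yes Cy) = T-cuts (λ _ → Cy) (λ _ → Cx)
  by-endpoints (no ¬Cx) (no ¬Cy) = T-cuts (⊥-elim ∘ ¬Cx) (⊥-elim ∘ ¬Cy)
  by-endpoints (yes Cx) (no ¬Cy) =
    cut-at-crossing G closedX closedY u∉T v∉T (λ { refl → ¬Cy Cu }) (λ { refl → ¬u⇝v Cx }) Cu ¬u⇝v
  by-endpoints (no ¬Cx) (yes Cy) =
    cut-at-crossing G closedY closedX u∉T v∉T (λ { refl → ¬Cx Cu }) (λ { refl → ¬u⇝v Cy }) Cu ¬u⇝v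

deleteEdges-cut-bound : ∀ (G : Graph n) {k} → (∀ S → DisconnectedOrTrivial G S → k ≤ ∣ S ∣) →
                        ∀ F S → DisconnectedOrTrivial (deleteEdges G F) S → k ≤ length F + ∣ S ∣
deleteEdges-cut-bound G bound [] S cuts = bound S cuts
deleteEdges-cut-bound G {k} bound ((x , y) ∷ F) S cuts = decidable-stable (k ≤? _) do
  (T , ∣T∣≤ , T-cuts) ← deleteEdge-cut (deleteEdges G F) x y cuts
  return (begin
    k                    ≤⟨ deleteEdges-cut-bound G bound F T T-cuts ⟩
    length F + ∣ T ∣     ≤⟨ +-monoʳ-≤ (length F) ∣T∣≤ ⟩
    length F + suc ∣ S ∣ ≡⟨ +-suc (length F) ∣ S ∣ ⟩
    suc (length F + ∣ S ∣) ∎)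
  where open ≤-Reasoning

module _ (G : Graph n) where

  connectivity-below : ∀ S → Acc _<_ ∣ S ∣ → DisconnectedOrTrivial G S →
                       ¬ ¬ (∃[ k ] (IsConnectivity G k × k ≤ ∣ S ∣))
  connectivity-below S (acc smaller) S-cuts = ¬¬-excluded-middle >>= by-minimality
    where
    SmallerCut : Set
    SmallerCut = ∃[ S′ ] (DisconnectedOrTrivial G S′ × ∣ S′ ∣ < ∣ S ∣)
    by-minimality : Dec SmallerCut → ¬ ¬ (∃[ k ] (IsConnectivity G k × k ≤ ∣ S ∣))
    by-minimality (yes (S′ , S′-cuts , ∣S′∣<∣S∣)) = do
      (k , κ , k≤∣S′∣) ← connectivity-below S′ (smaller ∣S′∣<∣S∣) S′-cuts
      return (k , κ , ≤-trans k≤∣S′∣ (<⇒≤ ∣S′∣<∣S∣))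
    by-minimality (no none) =
      return (∣ S ∣ , ((S , refl , S-cuts) , λ S′ S′-cuts → ≮⇒≥ λ lt → none (S′ , S′-cuts , lt)) , ≤-refl)

  δ≤cut : ∀ {δ} → MaximallyConnected G → IsMinDegree G δ →
          ∀ S → DisconnectedOrTrivial G S → δ ≤ ∣ S ∣
  δ≤cut {δ} maxConn minDeg S S-cuts = decidable-stable (δ ≤? ∣ S ∣) do
    (k , κ , k≤∣S∣) ← connectivity-below S (<-wellFounded ∣ S ∣) S-cuts
    return (subst (_≤ ∣ S ∣) (sym (maxConn δ k minDeg κ)) k≤∣S∣)

diagnosable-mono : ∀ {Adj Adj′ : Fin n → Fin n → Set} {t} → (∀ {u v} → Adj u v → Adj′ u v) →
                   Diagnosable Adj t → Diagnosable Adj′ t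
diagnosable-mono Adj⇒Adj′ diag F₁ F₂ F₁≢F₂ ∣F₁∣≤t ∣F₂∣≤t =
  Product.map₂ (Product.map₂ (Product.map₂ (Product.map₂ Adj⇒Adj′))) (diag F₁ F₂ F₁≢F₂ ∣F₁∣≤t ∣F₂∣≤t)

diagnosable-antitone : ∀ {Adj : Fin n → Fin n → Set} {s t} → s ≤ t → Diagnosable Adj t → Diagnosable Adj s
diagnosable-antitone s≤t diag F₁ F₂ F₁≢F₂ ∣F₁∣≤s ∣F₂∣≤s =
  diag F₁ F₂ F₁≢F₂ (≤-trans ∣F₁∣≤s s≤t) (≤-trans ∣F₂∣≤s s≤t)

-- Without an edge from outside U = F₁ ∪ F₂ into
-- A = F₁ △ F₂, the set A is closed in G - (F₁ ∩ F₂), so F₁ ∩ F₂ separates a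
-- vertex of A from a vertex outside U; but |F₁ ∩ F₂| < t.
diagnosable-from-cuts : ∀ (G : Graph n) t → 2 * t + 1 ≤ n →
                        (∀ S → DisconnectedOrTrivial G S → t ≤ ∣ S ∣) →
                        Diagnosable (λ u v → adj G u v ≡ true) t
diagnosable-from-cuts {n} G t size cut-bound F₁ F₂ F₁≢F₂ ∣F₁∣≤t ∣F₂∣≤t
  with any? (λ u → any? (λ v → ¬? (u ∈? F₁ ∪ F₂) ×-dec v ∈? F₁ △ F₂ ×-dec adj G u v ≟ᵇ true))
... | yes test-edge = test-edge
... | no no-test-edge = ⊥-elim (<⇒≱ ∣S∣<t (cut-bound S S-cuts))
  where
  S A : Subset n
  S = F₁ ∩ F₂
  A = F₁ △ F₂
  A-closed : Closed G S (_∈ A)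
  A-closed {c} {w} _ w∉S cw c∈A with w ∈? A
  ... | yes w∈A = w∈A
  ... | no w∉A = ⊥-elim (no-test-edge (w , c , w∉U , c∈A , trans (Graph.sym G w c) cw))
    where
    w∉U : w ∉ F₁ ∪ F₂
    w∉U w∈U = Sum.[ w∉S , w∉A ] (∪⊆∩∪△ F₁ F₂ w∈U)
  a : Fin n
  a = Product.proj₁ (≢⇒∃∈△ F₁≢F₂)
  a∈A : a ∈ A
  a∈A = Product.proj₂ (≢⇒∃∈△ F₁≢F₂)
  ∣U∣<n : ∣ F₁ ∪ F₂ ∣ < n
  ∣U∣<n = begin-strict
    ∣ F₁ ∪ F₂ ∣     ≤⟨ ∣p∪q∣≤∣p∣+∣q∣ F₁ F₂ ⟩
    ∣ F₁ ∣ + ∣ F₂ ∣ ≤⟨ +-mono-≤ ∣F₁∣≤t ∣F₂∣≤t ⟩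
    t + t           <⟨ n<1+n (t + t) ⟩
    suc (t + t)     ≡⟨ cong (suc ∘ (t +_)) (sym (+-identityʳ t)) ⟩
    suc (2 * t)     ≡⟨ +-comm 1 (2 * t) ⟩
    2 * t + 1       ≤⟨ size ⟩
    n               ∎
    where open ≤-Reasoning
  b : Fin n
  b = Product.proj₁ (∃∉ (F₁ ∪ F₂) ∣U∣<n)
  b∉U : b ∉ F₁ ∪ F₂
  b∉U = Product.proj₂ (∃∉ (F₁ ∪ F₂) ∣U∣<n)
  S-cuts : DisconnectedOrTrivial G S
  S-cuts = closed⇒disconnecting G A-closed (△∩-disjoint F₁ F₂ a∈A) (b∉U ∘ ∩⊆∪ F₁ F₂) a∈A (b∉U ∘ △⊆∪ F₁ F₂)
  ∣S∣<t : ∣ S ∣ < t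
  ∣S∣<t with x∈p△q⁻ F₁ F₂ a∈A
  ... | inj₁ (a∈F₁ , a∉F₂) = <-≤-trans (∣p∩q∣<∣p∣ F₁ F₂ a∈F₁ a∉F₂) ∣F₁∣≤t
  ... | inj₂ (a∈F₂ , a∉F₁) = <-≤-trans (∣p∩q∣<∣q∣ F₁ F₂ a∈F₂ a∉F₁) ∣F₂∣≤t

lower-bound : ∀ (G : Graph n) δ h → MaximallyConnected G → IsMinDegree G δ →
              2 * (δ ∸ h) + 1 ≤ n → EdgeTolerableDiagnosable G h (δ ∸ h)
lower-bound G δ h maxConn minDeg size F _ ∣F∣≤h =
  diagnosable-mono (deleteEdges-adj⁻ G F) (diagnosable-from-cuts (deleteEdges G F) (δ ∸ h) size cut-bound)
  where
  cut-bound : ∀ S → DisconnectedOrTrivial (deleteEdges G F) S → δ ∸ h ≤ ∣ S ∣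
  cut-bound S S-cuts = m≤n+o⇒m∸n≤o δ h (begin
    δ                ≤⟨ deleteEdges-cut-bound G (δ≤cut G maxConn minDeg) F S S-cuts ⟩
    length F + ∣ S ∣ ≤⟨ +-monoˡ-≤ ∣ S ∣ ∣F∣≤h ⟩
    h + ∣ S ∣        ∎)
    where open ≤-Reasoning

removed : ℕ → Subset n → List (Fin n)
removed zero p = []
removed (suc k) [] = []
removed (suc k) (outside ∷ p) = map Fin.suc (removed (suc k) p)
removed (suc k) (inside ∷ p) = Fin.zero ∷ map Fin.suc (removed k p)

kept : ℕ → Subset n → Subset n
kept zero p = p
kept (suc k) [] = []
kept (suc k) (outside ∷ p) = outside ∷ kept (suc k) p
kept (suc k) (inside ∷ p) = outside ∷ kept k p

removed-length : ∀ k (p : Subset n) → length (removed k p) ≤ k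
removed-length zero p = z≤n
removed-length (suc k) [] = z≤n
removed-length (suc k) (outside ∷ p) =
  ≤-trans (≤-reflexive (length-map Fin.suc (removed (suc k) p))) (removed-length (suc k) p)
removed-length (suc k) (inside ∷ p) =
  s≤s (≤-trans (≤-reflexive (length-map Fin.suc (removed k p))) (removed-length k p))

∣kept∣ : ∀ k (p : Subset n) → ∣ kept k p ∣ ≤ ∣ p ∣ ∸ k
∣kept∣ zero p = ≤-refl
∣kept∣ (suc k) [] = z≤n
∣kept∣ (suc k) (outside ∷ p) = ∣kept∣ (suc k) p
∣kept∣ (suc k) (inside ∷ p) = ∣kept∣ k p

kept⊆ : ∀ k (p : Subset n) → kept k p ⊆ p
kept⊆ zero p x∈ = x∈
kept⊆ (suc k) (outside ∷ p) (there x∈) = there (kept⊆ (suc k) p x∈)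
kept⊆ (suc k) (inside ∷ p) (there x∈) = there (kept⊆ k p x∈)

removed⊆ : ∀ k (p : Subset n) {x} → x ∈ₗ removed k p → x ∈ p
removed⊆ (suc k) (outside ∷ p) x∈ with ∈-map⁻ Fin.suc x∈
... | y , y∈ , refl = there (removed⊆ (suc k) p y∈)
removed⊆ (suc k) (inside ∷ p) (here refl) = here
removed⊆ (suc k) (inside ∷ p) (there x∈) with ∈-map⁻ Fin.suc x∈
... | y , y∈ , refl = there (removed⊆ k p y∈)

kept∪removed : ∀ k (p : Subset n) {x} → x ∈ p → x ∈ kept k p ⊎ x ∈ₗ removed k p
kept∪removed zero p x∈ = inj₁ x∈
kept∪removed (suc k) (outside ∷ p) (there x∈) =
  Sum.map there (∈-map⁺ Fin.suc) (kept∪removed (suc k) p x∈)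
kept∪removed (suc k) (inside ∷ p) here = inj₂ (here refl)
kept∪removed (suc k) (inside ∷ p) (there x∈) =
  Sum.map there (there ∘ ∈-map⁺ Fin.suc) (kept∪removed k p x∈)

neighbours : Graph n → Fin n → Subset n
neighbours G v = tabulate (adj G v)

∈neighbours⁻ : ∀ (G : Graph n) {v w} → w ∈ neighbours G v → adj G v w ≡ true
∈neighbours⁻ G {v} {w} w∈ = trans (sym (lookup∘tabulate (adj G v) w)) ([]=⇒lookup w∈)

∈neighbours⁺ : ∀ (G : Graph n) {v w} → adj G v w ≡ true → w ∈ neighbours G v
∈neighbours⁺ G {v} {w} vw = lookup⇒[]= w (neighbours G v) (trans (lookup∘tabulate (adj G v) w) vw)

x∈p△[p∪⁅y⁆]⇒x≡y : ∀ {p : Subset n} {x y} → x ∈ p △ (p ∪ ⁅ y ⁆) → x ≡ y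
x∈p△[p∪⁅y⁆]⇒x≡y {p = p} {y = y} x∈ with x∈p△q⁻ p (p ∪ ⁅ y ⁆) x∈
... | inj₁ (x∈p , x∉p∪y) = ⊥-elim (x∉p∪y (x∈p∪q⁺ (inj₁ x∈p)))
... | inj₂ (x∈p∪y , x∉p) = Sum.[ ⊥-elim ∘ x∉p , x∈⁅y⁆⇒x≡y y ] (x∈p∪q⁻ p ⁅ y ⁆ x∈p∪y)

-- At a vertex v of degree δ delete h of its edges and let P be the remaining
-- neighbours of v.  The fault sets P and P ∪ {v}, of sizes at most δ - h + 1,
-- differ only in v, and every edge of G - F at v ends in P; so G - F is not
-- (δ - h + 1)-diagnosable.
not-diagnosable : ∀ (G : Graph n) δ h → IsMinDegree G δ →
                  ∃[ F ] (EdgesOf G F × length F ≤ h × ¬ Diagnosable (AdjMinus G F) (suc (δ ∸ h)))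
not-diagnosable G δ h ((v , deg≡δ) , _) = F , F-edges , ∣F∣≤h , indistinguishable
  where
  N P : Subset _
  N = neighbours G v
  P = kept h N
  F : EdgeList _
  F = map (v ,_) (removed h N)
  F-edges : EdgesOf G F
  F-edges uw∈F with ∈-map⁻ (v ,_) uw∈F
  ... | w , w∈ , refl = ∈neighbours⁻ G (removed⊆ h N w∈)
  ∣F∣≤h : length F ≤ h
  ∣F∣≤h = ≤-trans (≤-reflexive (length-map (v ,_) (removed h N))) (removed-length h N)
  ∣P∣≤δ∸h : ∣ P ∣ ≤ δ ∸ h
  ∣P∣≤δ∸h = subst (λ d → ∣ P ∣ ≤ d ∸ h) deg≡δ (∣kept∣ h N)
  v∉P : v ∉ P
  v∉P v∈P with trans (sym (Graph.irrefl G v)) (∈neighbours⁻ G (kept⊆ h N v∈P))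
  ... | ()
  P≢P∪v : P ≢ P ∪ ⁅ v ⁆
  P≢P∪v P≡ = v∉P (subst (v ∈_) (sym P≡) (x∈p∪q⁺ (inj₂ (x∈⁅x⁆ v))))
  indistinguishable : ¬ Diagnosable (AdjMinus G F) (suc (δ ∸ h))
  indistinguishable diag
    with diag P (P ∪ ⁅ v ⁆) P≢P∪v (m≤n⇒m≤1+n ∣P∣≤δ∸h) (≤-trans (∣p∪⁅x⁆∣≤1+∣p∣ P v) (s≤s ∣P∣≤δ∸h))
  ... | u , w , u∉ , w∈ , uw , _ , wu∉F with x∈p△[p∪⁅y⁆]⇒x≡y w∈
  ... | refl with kept∪removed h N (∈neighbours⁺ G (trans (Graph.sym G v u) uw))
  ... | inj₁ u∈P = u∉ (x∈p∪q⁺ (inj₁ u∈P))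
  ... | inj₂ u∈removed = wu∉F (∈-map⁺ (v ,_) u∈removed)

upper-bound : ∀ (G : Graph n) δ h → IsMinDegree G δ →
              ∀ t → EdgeTolerableDiagnosable G h t → t ≤ δ ∸ h
upper-bound G δ h minDeg t diag with not-diagnosable G δ h minDeg
... | F , F-edges , ∣F∣≤h , ¬diag =
  ≮⇒≥ λ δ∸h<t → ¬diag (diagnosable-antitone δ∸h<t (diag F F-edges ∣F∣≤h))

-- The two bounds together.
theorem3p3 : ∀ {n} (G : Graph n) (δ h : ℕ) →
    MaximallyConnected G → IsMinDegree G δ →
    h ≤ δ → 2 * (δ ∸ h) + 1 ≤ n →
    IsEdgeTolerableDiagnosability G h (δ ∸ h)
theorem3p3 G δ h maxConn minDeg _ size =
  lower-bound G δ h maxConn minDeg size , upper-bound G δ h minDeg
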